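{- Let $n\geq 5$ and let $R_4$ be the POP of size 4 with the single relation $1>4$. If $\pi$ is an $n$-permutation avoiding $R_4$, then $\pi$ is sum decomposable. Moreover, if $\alpha\oplus\beta$ avoids $R_4$ for permutations $\alpha,\beta$ with $\alpha$ sum indecomposable, then $\alpha\in\{1, 21, 231, 321, 312, 2413\}$.
   Context: An $n$-permutation $\pi$ contains $R_4$ iff there are indices $i_1<i_2<i_3<i_4$ with $\pi_{i_1}>\pi_{i_4}$; otherwise it avoids $R_4$. For permutations $\alpha,\beta$ of lengths $a,b$, $\alpha\oplus\beta=\alpha_1\cdots\alpha_a(\beta_1+a)\cdots(\beta_b+a)$. A permutation is sum decomposable if it equals $\alpha\oplus\beta$ for some nonempty permutations $\alpha,\beta$, and sum indecomposable otherwise. -}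

module Defs where

open import Data.Nat using (ℕ; suc; _+_; _<_; _>_)
open import Data.List using (List; []; _∷_; length; map; upTo; _++_; lookup)
open import Data.List.Relation.Binary.Permutation.Propositional using (_↭_)
open import Data.Fin using (Fin; toℕ)
open import Data.Product using (∃; ∃-syntax; Σ-syntax; _×_)
open import Relation.Nullary using (¬_)
open import Relation.Binary.PropositionalEquality using (_≡_; _≢_)

-- A permutation in one-line notation: a list of naturals which is a
-- rearrangement of 1, 2, …, n where n is its length.
IsPerm : List ℕ → Set
IsPerm π = π ↭ map suc (upTo (length π))

_⊕_ : List ℕ → List ℕ → List ℕ
α ⊕ β = α ++ map (_+ length α) β

ContainsR4 : List ℕ → Set
ContainsR4 π = Σ[ i₁ ∈ Fin (length π) ] Σ[ i₂ ∈ Fin (length π) ]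
  Σ[ i₃ ∈ Fin (length π) ] Σ[ i₄ ∈ Fin (length π) ]
  (toℕ i₁ < toℕ i₂ × toℕ i₂ < toℕ i₃ × toℕ i₃ < toℕ i₄ ×
   lookup π i₁ > lookup π i₄)

AvoidsR4 : List ℕ → Set
AvoidsR4 π = ¬ ContainsR4 π

SumDecomposable : List ℕ → Set
SumDecomposable π = ∃[ α ] ∃[ β ]
  (IsPerm α × IsPerm β × α ≢ [] × β ≢ [] × π ≡ α ⊕ β)

SumIndecomposable : List ℕ → Set
SumIndecomposable π = ¬ SumDecomposable π

-- In an R₄-avoider every entry is at most every entry three or more places later, so a value
-- not exceeding π(i) that occurs from position i on sits at i, i+1 or i+2.  Locating 1, 2, 3, 4
-- this way shows that an R₄-avoiding permutation of length at least 4 begins with one of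
-- 1, 21, 231, 321, 312, 2413, a prefix that is itself a permutation; for length at least 5 it
-- is proper and splits π as a direct sum.  For the second claim apply this to α ⊕ 1234, which
-- still avoids R₄: the prefix found there is comparable with α, and neither is a proper prefix
-- of the other, because α is sum indecomposable and no listed permutation has a proper prefix
-- that is a permutation.
module Submission where

open import Defs
open import Data.Nat using (ℕ; _≤_)
open import Data.List using (List; []; _∷_; length)
open import Data.List.Membership.Propositional using (_∈_)
open import Data.Product using (_×_)
open import Relation.Binary.PropositionalEquality using (_≡_; _≢_)

open import Data.Nat using (zero; suc; _+_; _∸_; _<_; z≤n; s≤s; _≤?_)
open import Data.Nat.Properties
  using (≤∧≢⇒<; ≮⇒≥; ≤-antisym; ≤-trans; ≤⇒≯; <⇒≤; m≤n+m; +-comm; +-monoˡ-≤; m+1+n≰m; suc-injective)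
open import Data.List using (map; upTo; applyUpTo; _++_; drop; take)
open import Data.List.Properties using (length-++; length-map; map-upTo; map-∘; map-cong; ++-identityʳ; drop-map; ∷-injective)
open import Data.List.Relation.Unary.All as All using (All; []; _∷_)
import Data.List.Relation.Unary.All.Properties as All
open import Data.List.Relation.Unary.Any as Any using (here; there)
open import Data.List.Relation.Unary.Any.Properties using (lookup-index)
open import Data.List.Membership.Propositional.Properties using (∈-map⁺; ∈-map⁻; ∈-upTo⁺; ∈-upTo⁻)
open import Data.List.Relation.Unary.Unique.Propositional using (Unique; []; _∷_)
import Data.List.Relation.Unary.Unique.Propositional.Properties as Unique
open import Data.List.Relation.Binary.Permutation.Propositional
  using (_↭_; prep; swap; ↭-refl; ↭-sym; ↭-trans; ↭⇒↭ₛ)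
open import Data.List.Relation.Binary.Permutation.Propositional.Properties
  using (∈-resp-↭; ++⁺; ++⁺ʳ; map⁺; drop-∷; ↭-map-inv)
import Data.List.Relation.Binary.Permutation.Setoid.Properties as Permutationₛ
open import Data.Fin using () renaming (zero to fz; suc to fs)
open import Data.Product using (_,_; proj₁; proj₂; ∃-syntax; -,_)
open import Data.Sum using (_⊎_; inj₁; inj₂)
open import Data.Empty using (⊥-elim)
open import Data.Unit using (⊤; tt)
open import Function using (_∘_)
open import Relation.Nullary using (¬_)
open import Relation.Nullary.Decidable using (from-yes)
open import Relation.Binary.PropositionalEquality using (refl; sym; trans; cong; cong₂; subst; ≢-sym; setoid; module ≡-Reasoning)

private
  variable
    A : Set

drop-++ : ∀ n (xs ys : List A) → drop n (xs ++ ys) ≡ drop n xs ++ drop (n ∸ length xs) ys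
drop-++ zero    []       ys = refl
drop-++ zero    (x ∷ xs) ys = refl
drop-++ (suc n) []       ys = refl
drop-++ (suc n) (x ∷ xs) ys = drop-++ n xs ys

take-length-++ : ∀ (xs ys : List A) → take (length xs) (xs ++ ys) ≡ xs
take-length-++ []       ys = refl
take-length-++ (x ∷ xs) ys = cong (x ∷_) (take-length-++ xs ys)

applyUpTo-+ : ∀ (f : ℕ → A) k l → applyUpTo f (k + l) ≡ applyUpTo f k ++ applyUpTo (f ∘ (k +_)) l
applyUpTo-+ f zero    l = refl
applyUpTo-+ f (suc k) l = cong (f 0 ∷_) (applyUpTo-+ (f ∘ suc) k l)

prefixes-comparable : ∀ (xs ys us vs : List A) → xs ++ ys ≡ us ++ vs →
                      (∃[ w ] us ≡ xs ++ w) ⊎ (∃[ w ] xs ≡ us ++ w)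
prefixes-comparable []       ys us       vs eq = inj₁ (us , refl)
prefixes-comparable (x ∷ xs) ys []       vs eq = inj₂ (x ∷ xs , refl)
prefixes-comparable (x ∷ xs) ys (u ∷ us) vs eq with refl , eq′ ← ∷-injective eq
  with prefixes-comparable xs ys us vs eq′
... | inj₁ (w , us≡xs++w) = inj₁ (w , cong (x ∷_) us≡xs++w)
... | inj₂ (w , xs≡us++w) = inj₂ (w , cong (x ∷_) xs≡us++w)

↭-++-cancelˡ : ∀ (xs : List A) {ys zs} → xs ++ ys ↭ xs ++ zs → ys ↭ zs
↭-++-cancelˡ []       p = p
↭-++-cancelˡ (x ∷ xs) p = ↭-++-cancelˡ xs (drop-∷ p)

idPerm : ℕ → List ℕ
idPerm n = map suc (upTo n)

idPerm-+ : ∀ k l → idPerm (k + l) ≡ idPerm k ++ map (_+ k) (idPerm l)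
idPerm-+ k l = begin
  idPerm (k + l)                                  ≡⟨ map-upTo suc (k + l) ⟩
  applyUpTo suc (k + l)                           ≡⟨ applyUpTo-+ suc k l ⟩
  applyUpTo suc k ++ applyUpTo (suc ∘ (k +_)) l   ≡⟨ cong₂ _++_ (sym (map-upTo suc k)) (sym shifted) ⟩
  idPerm k ++ map (_+ k) (idPerm l)               ∎
  where
  open ≡-Reasoning
  shifted : map (_+ k) (idPerm l) ≡ applyUpTo (suc ∘ (k +_)) l
  shifted = begin
    map (_+ k) (map suc (upTo l))   ≡⟨ sym (map-∘ (upTo l)) ⟩
    map (λ i → suc i + k) (upTo l)  ≡⟨ map-cong (λ i → cong suc (+-comm i k)) (upTo l) ⟩
    map (suc ∘ (k +_)) (upTo l)     ≡⟨ map-upTo (suc ∘ (k +_)) l ⟩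
    applyUpTo (suc ∘ (k +_)) l      ∎

∈-idPerm⁺ : ∀ {v n} → 1 ≤ v → v ≤ n → v ∈ idPerm n
∈-idPerm⁺ {suc u} _ u<n = ∈-map⁺ suc (∈-upTo⁺ u<n)

∈-idPerm⁻ : ∀ {v n} → v ∈ idPerm n → 1 ≤ v × v ≤ n
∈-idPerm⁻ v∈ with u , u∈ , refl ← ∈-map⁻ suc v∈ = s≤s z≤n , ∈-upTo⁻ u∈

perm-unique : ∀ {π} → IsPerm π → Unique π
perm-unique {π} p =
  Permutationₛ.Unique-resp-↭ (setoid ℕ) (↭⇒↭ₛ (↭-sym p)) (Unique.map⁺ suc-injective (Unique.upTo⁺ (length π)))

perm-∈⁺ : ∀ {π v} → IsPerm π → 1 ≤ v → v ≤ length π → v ∈ π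
perm-∈⁺ p 1≤v v≤n = ∈-resp-↭ (↭-sym p) (∈-idPerm⁺ 1≤v v≤n)

perm-positive : ∀ {π} → IsPerm π → All (1 ≤_) π
perm-positive p = All.tabulate (proj₁ ∘ ∈-idPerm⁻ ∘ ∈-resp-↭ p)

perm-bounded : ∀ {π} → IsPerm π → All (_≤ length π) π
perm-bounded p = All.tabulate (proj₂ ∘ ∈-idPerm⁻ ∘ ∈-resp-↭ p)

length-⊕ : ∀ (α β : List ℕ) → length (α ⊕ β) ≡ length α + length β
length-⊕ α β = trans (length-++ α) (cong (length α +_) (length-map _ β))

⊕-isPerm : ∀ {α β} → IsPerm α → IsPerm β → IsPerm (α ⊕ β)
⊕-isPerm {α} {β} pα pβ = subst (α ⊕ β ↭_) identity (++⁺ pα (map⁺ (_+ length α) pβ))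
  where
  identity : idPerm (length α) ++ map (_+ length α) (idPerm (length β)) ≡ idPerm (length (α ⊕ β))
  identity = trans (sym (idPerm-+ (length α) (length β))) (cong idPerm (sym (length-⊕ α β)))

perm-suffix : ∀ {α w} → IsPerm (α ++ w) → IsPerm α → w ↭ map (_+ length α) (idPerm (length w))
perm-suffix {α} {w} p pα = ↭-++-cancelˡ (idPerm (length α)) (↭-trans (++⁺ʳ w (↭-sym pα)) split)
  where
  split : α ++ w ↭ idPerm (length α) ++ map (_+ length α) (idPerm (length w))
  split = subst (α ++ w ↭_)
    (trans (cong idPerm (length-++ α)) (idPerm-+ (length α) (length w))) p

perm-prefix⇒decomposable : ∀ {α w} → IsPerm (α ++ w) → IsPerm α → α ≢ [] → w ≢ [] → SumDecomposable (α ++ w)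
perm-prefix⇒decomposable {α} {w} p pα α≢[] w≢[]
  with β , refl , idPerm↭β ← ↭-map-inv (_+ length α) (↭-sym (perm-suffix p pα)) =
  α , β , pα , pβ , α≢[] , (λ { refl → w≢[] refl }) , refl
  where
  pβ : IsPerm β
  pβ = subst (λ n → β ↭ idPerm n) (length-map (_+ length α) β) (↭-sym idPerm↭β)

-- drop 2 xs consists of the entries at least three places after x.
R4Free : List ℕ → Set
R4Free []       = ⊤
R4Free (x ∷ xs) = All (x ≤_) (drop 2 xs) × R4Free xs

avoids⇒R4Free : ∀ π → AvoidsR4 π → R4Free π
avoids⇒R4Free []       _  = tt
avoids⇒R4Free (x ∷ xs) av = head-bound xs av , avoids⇒R4Free xs tail-avoids
  where
  tail-avoids : AvoidsR4 xs
  tail-avoids (i₁ , i₂ , i₃ , i₄ , i₁<i₂ , i₂<i₃ , i₃<i₄ , gt) =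
    av (fs i₁ , fs i₂ , fs i₃ , fs i₄ , s≤s i₁<i₂ , s≤s i₂<i₃ , s≤s i₃<i₄ , gt)
  head-bound : ∀ xs → AvoidsR4 (x ∷ xs) → All (x ≤_) (drop 2 xs)
  head-bound []           _  = []
  head-bound (_ ∷ [])     _  = []
  head-bound (_ ∷ _ ∷ ws) av = All.tabulate λ v∈ws → ≮⇒≥ λ v<x →
    av (fz , fs fz , fs (fs fz) , fs (fs (fs (Any.index v∈ws))) ,
        s≤s z≤n , s≤s (s≤s z≤n) , s≤s (s≤s (s≤s z≤n)) , subst (_< x) (lookup-index v∈ws) v<x)

R4Free-++ˡ : ∀ xs {ys} → R4Free (xs ++ ys) → R4Free xs
R4Free-++ˡ []       _               = tt
R4Free-++ˡ (x ∷ xs) {ys} (h , free) =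
  All.++⁻ˡ (drop 2 xs) (subst (All (x ≤_)) (drop-++ 2 xs ys) h) , R4Free-++ˡ xs free

R4Free-++ : ∀ {m} xs {ys} → All (_≤ m) xs → All (m ≤_) ys → R4Free xs → R4Free ys → R4Free (xs ++ ys)
R4Free-++ []       _               _    _               free-ys = free-ys
R4Free-++ (x ∷ xs) {ys} (x≤m ∷ xs≤m) m≤ys (h , free-xs) free-ys =
  subst (All (x ≤_)) (sym (drop-++ 2 xs ys)) (All.++⁺ h (All.drop⁺ (2 ∸ length xs) (All.map (≤-trans x≤m) m≤ys))) ,
  R4Free-++ xs xs≤m m≤ys free-xs free-ys

R4Free-map : ∀ {f : ℕ → ℕ} → (∀ {x y} → x ≤ y → f x ≤ f y) → ∀ xs → R4Free xs → R4Free (map f xs)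
R4Free-map     mono []       _           = tt
R4Free-map {f} mono (x ∷ xs) (h , free) =
  subst (All (f x ≤_)) (sym (drop-map 2 xs)) (All.map⁺ (All.map mono h)) , R4Free-map mono xs free

R4Free-⊕ : ∀ {α β} → All (_≤ length α) α → R4Free α → R4Free β → R4Free (α ⊕ β)
R4Free-⊕ {α} {β} bounded free-α free-β =
  R4Free-++ α bounded (All.map⁺ (All.universal (m≤n+m (length α)) β)) free-α
    (R4Free-map (+-monoˡ-≤ (length α)) β free-β)

idPerm4-R4Free : R4Free (idPerm 4)
idPerm4-R4Free = (s≤s z≤n ∷ []) , [] , [] , [] , tt

among-first-three : ∀ {x y z ws v} → All (x ≤_) ws → v ∈ x ∷ y ∷ z ∷ ws → v ≤ x → v ≡ x ⊎ v ≡ y ⊎ v ≡ z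
among-first-three _    (here v≡x)                  _   = inj₁ v≡x
among-first-three _    (there (here v≡y))          _   = inj₂ (inj₁ v≡y)
among-first-three _    (there (there (here v≡z)))  _   = inj₂ (inj₂ v≡z)
among-first-three x≤ws (there (there (there v∈ws))) v≤x = inj₁ (≤-antisym v≤x (All.lookup x≤ws v∈ws))

indecomposableAvoiders : List (List ℕ)
indecomposableAvoiders =
  (1 ∷ []) ∷ (2 ∷ 1 ∷ []) ∷ (2 ∷ 3 ∷ 1 ∷ []) ∷ (3 ∷ 2 ∷ 1 ∷ []) ∷ (3 ∷ 1 ∷ 2 ∷ []) ∷ (2 ∷ 4 ∷ 1 ∷ 3 ∷ []) ∷ []

indecomposableAvoiders-isPerm : All IsPerm indecomposableAvoiders
indecomposableAvoiders-isPerm =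
  ↭-refl ∷
  swap 2 1 ↭-refl ∷
  ↭-trans (prep 2 (swap 3 1 ↭-refl)) (swap 2 1 ↭-refl) ∷
  ↭-trans (swap 3 2 ↭-refl) (↭-trans (prep 2 (swap 3 1 ↭-refl)) (swap 2 1 ↭-refl)) ∷
  ↭-trans (swap 3 1 ↭-refl) (prep 1 (swap 3 2 ↭-refl)) ∷
  ↭-trans (prep 2 (swap 4 1 ↭-refl)) (swap 2 1 (swap 4 3 ↭-refl)) ∷ []

indecomposableAvoiders-nonempty : All (_≢ []) indecomposableAvoiders
indecomposableAvoiders-nonempty = (λ ()) ∷ (λ ()) ∷ (λ ()) ∷ (λ ()) ∷ (λ ()) ∷ (λ ()) ∷ []

indecomposableAvoiders-length≤4 : All ((_≤ 4) ∘ length) indecomposableAvoiders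
indecomposableAvoiders-length≤4 = from-yes (All.all? ((_≤? 4) ∘ length) indecomposableAvoiders)

bounded-prefix-is-whole : ∀ {x} → x ∈ indecomposableAvoiders →
                          ∀ k → All (_≤ suc k) (take (suc k) x) → length x ≤ suc k
bounded-prefix-is-whole (here refl)                 _             _ = s≤s z≤n
bounded-prefix-is-whole (there (here refl))         zero          (s≤s () ∷ _)
bounded-prefix-is-whole (there (here refl))         (suc _)       _ = s≤s (s≤s z≤n)
bounded-prefix-is-whole (there (there (here refl))) zero          (s≤s () ∷ _)
bounded-prefix-is-whole (there (there (here refl))) (suc zero)    (_ ∷ s≤s (s≤s ()) ∷ _)
bounded-prefix-is-whole (there (there (here refl))) (suc (suc _)) _ = s≤s (s≤s (s≤s z≤n))
bounded-prefix-is-whole (there (there (there (here refl)))) zero          (s≤s () ∷ _)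
bounded-prefix-is-whole (there (there (there (here refl)))) (suc zero)    (s≤s (s≤s ()) ∷ _)
bounded-prefix-is-whole (there (there (there (here refl)))) (suc (suc _)) _ = s≤s (s≤s (s≤s z≤n))
bounded-prefix-is-whole (there (there (there (there (here refl))))) zero          (s≤s () ∷ _)
bounded-prefix-is-whole (there (there (there (there (here refl))))) (suc zero)    (s≤s (s≤s ()) ∷ _)
bounded-prefix-is-whole (there (there (there (there (here refl))))) (suc (suc _)) _ = s≤s (s≤s (s≤s z≤n))
bounded-prefix-is-whole (there (there (there (there (there (here refl)))))) zero (s≤s () ∷ _)
bounded-prefix-is-whole (there (there (there (there (there (here refl)))))) (suc zero) (_ ∷ s≤s (s≤s ()) ∷ _)
bounded-prefix-is-whole (there (there (there (there (there (here refl)))))) (suc (suc zero))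
  (_ ∷ s≤s (s≤s (s≤s ())) ∷ _)
bounded-prefix-is-whole (there (there (there (there (there (here refl)))))) (suc (suc (suc _))) _ =
  s≤s (s≤s (s≤s (s≤s z≤n)))
bounded-prefix-is-whole (there (there (there (there (there (there ())))))) _ _

proper-prefix-unbounded : ∀ {α y w} → α ++ y ∷ w ∈ indecomposableAvoiders → α ≢ [] → ¬ All (_≤ length α) α
proper-prefix-unbounded {[]}             _   α≢[] _       = α≢[] refl
proper-prefix-unbounded {x ∷ xs} {y} {w} mem _    bounded =
  m+1+n≰m (length (x ∷ xs)) (subst (_≤ length (x ∷ xs)) (length-++ (x ∷ xs)) whole)
  where
  whole : length ((x ∷ xs) ++ y ∷ w) ≤ length (x ∷ xs)
  whole = bounded-prefix-is-whole mem (length xs)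
    (subst (All (_≤ length (x ∷ xs))) (sym (take-length-++ (x ∷ xs) (y ∷ w))) bounded)

HasPrefixIn : List (List ℕ) → List ℕ → Set
HasPrefixIn S π = ∃[ α ] ∃[ r ] (α ∈ S × π ≡ α ++ r)

-- A value at most a lies among a, b, c and one at most b among b, c, d; the lower bounds on a
-- and b that this needs come from distinctness from the values already placed.
begins-with-indecomposable : ∀ {a b c d rest} → Unique (a ∷ b ∷ c ∷ d ∷ rest) →
  All (1 ≤_) (a ∷ b ∷ c ∷ d ∷ rest) → R4Free (a ∷ b ∷ c ∷ d ∷ rest) →
  1 ∈ a ∷ b ∷ c ∷ d ∷ rest → 2 ∈ a ∷ b ∷ c ∷ d ∷ rest →
  3 ∈ a ∷ b ∷ c ∷ d ∷ rest → 4 ∈ a ∷ b ∷ c ∷ d ∷ rest →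
  HasPrefixIn indecomposableAvoiders (a ∷ b ∷ c ∷ d ∷ rest)
begins-with-indecomposable ((a≢b ∷ a≢c ∷ _) ∷ (b≢c ∷ b≢d ∷ _) ∷ _) (1≤a ∷ 1≤b ∷ _) (a≤ , b≤ , _) ∈1 ∈2 ∈3 ∈4
  with among-first-three a≤ ∈1 1≤a
... | inj₁ refl = -, -, here refl , refl
... | inj₂ (inj₁ refl) with among-first-three a≤ ∈2 (≤∧≢⇒< 1≤a (≢-sym a≢b))
...   | inj₁ refl = -, -, there (here refl) , refl
...   | inj₂ (inj₁ ())
...   | inj₂ (inj₂ refl) with among-first-three a≤ ∈3 (≤∧≢⇒< (≤∧≢⇒< 1≤a (≢-sym a≢b)) (≢-sym a≢c))
...     | inj₁ refl = -, -, there (there (there (there (here refl)))) , refl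
...     | inj₂ (inj₁ ())
...     | inj₂ (inj₂ ())
begins-with-indecomposable ((a≢b ∷ a≢c ∷ _) ∷ (b≢c ∷ b≢d ∷ _) ∷ _) (1≤a ∷ 1≤b ∷ _) (a≤ , b≤ , _) ∈1 ∈2 ∈3 ∈4
  | inj₂ (inj₂ refl) with among-first-three a≤ ∈2 (≤∧≢⇒< 1≤a (≢-sym a≢c))
...   | inj₂ (inj₂ ())
...   | inj₂ (inj₁ refl) with among-first-three a≤ ∈3 (≤∧≢⇒< (≤∧≢⇒< 1≤a (≢-sym a≢c)) (≢-sym a≢b))
...     | inj₁ refl = -, -, there (there (there (here refl))) , refl
...     | inj₂ (inj₁ ())
...     | inj₂ (inj₂ ())
begins-with-indecomposable ((a≢b ∷ a≢c ∷ _) ∷ (b≢c ∷ b≢d ∷ _) ∷ _) (1≤a ∷ 1≤b ∷ _) (a≤ , b≤ , _) ∈1 ∈2 ∈3 ∈4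
  | inj₂ (inj₂ refl) | inj₁ refl
  with among-first-three b≤ (Any.tail (λ ()) ∈3) (≤∧≢⇒< (≤∧≢⇒< 1≤b (≢-sym b≢c)) a≢b)
...   | inj₁ refl = -, -, there (there (here refl)) , refl
...   | inj₂ (inj₁ ())
...   | inj₂ (inj₂ refl)
  with among-first-three b≤ (Any.tail (λ ()) ∈4) (≤∧≢⇒< (≤∧≢⇒< (≤∧≢⇒< 1≤b (≢-sym b≢c)) a≢b) (≢-sym b≢d))
...     | inj₁ refl = -, -, there (there (there (there (there (here refl))))) , refl
...     | inj₂ (inj₁ ())
...     | inj₂ (inj₂ ())

perm-begins-with-indecomposable : ∀ {π} → IsPerm π → 4 ≤ length π → R4Free π →
                                  HasPrefixIn indecomposableAvoiders π
perm-begins-with-indecomposable {a ∷ b ∷ c ∷ d ∷ _} p (s≤s (s≤s (s≤s (s≤s _)))) free =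
  begins-with-indecomposable (perm-unique p) (perm-positive p) free
    (perm-∈⁺ p (s≤s z≤n) (s≤s z≤n))
    (perm-∈⁺ p (s≤s z≤n) (s≤s (s≤s z≤n)))
    (perm-∈⁺ p (s≤s z≤n) (s≤s (s≤s (s≤s z≤n))))
    (perm-∈⁺ p (s≤s z≤n) (s≤s (s≤s (s≤s (s≤s z≤n)))))
perm-begins-with-indecomposable {[]}                  _ ()
perm-begins-with-indecomposable {_ ∷ []}              _ (s≤s ())
perm-begins-with-indecomposable {_ ∷ _ ∷ []}          _ (s≤s (s≤s ()))
perm-begins-with-indecomposable {_ ∷ _ ∷ _ ∷ []}      _ (s≤s (s≤s (s≤s ())))

R4Free-perm-decomposable : ∀ {π} → IsPerm π → 5 ≤ length π → R4Free π → SumDecomposable π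
R4Free-perm-decomposable p 5≤|π| free with perm-begins-with-indecomposable p (<⇒≤ 5≤|π|) free
... | α , r , α∈ , refl =
  perm-prefix⇒decomposable p (All.lookup indecomposableAvoiders-isPerm α∈)
    (All.lookup indecomposableAvoiders-nonempty α∈) r≢[]
  where
  r≢[] : r ≢ []
  r≢[] refl = ≤⇒≯ (All.lookup indecomposableAvoiders-length≤4 α∈)
    (subst (4 <_) (cong length (++-identityʳ α)) 5≤|π|)

indecomposable-R4Free-listed : ∀ {α} → IsPerm α → α ≢ [] → SumIndecomposable α → R4Free α →
                               α ∈ indecomposableAvoiders
indecomposable-R4Free-listed {α} pα α≢[] indec free
  with perm-begins-with-indecomposable (⊕-isPerm {β = idPerm 4} pα ↭-refl)
         (subst (4 ≤_) (sym (length-⊕ α (idPerm 4))) (m≤n+m 4 (length α)))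
         (R4Free-⊕ (perm-bounded pα) free idPerm4-R4Free)
... | α′ , r , α′∈ , eq with prefixes-comparable α _ α′ r eq
... | inj₁ ([]    , refl) = subst (_∈ indecomposableAvoiders) (++-identityʳ α) α′∈
... | inj₁ (_ ∷ _ , refl) = ⊥-elim (proper-prefix-unbounded α′∈ α≢[] (perm-bounded pα))
... | inj₂ ([]    , refl) = subst (_∈ indecomposableAvoiders) (sym (++-identityʳ α′)) α′∈
... | inj₂ (_ ∷ _ , refl) = ⊥-elim (indec (perm-prefix⇒decomposable pα
        (All.lookup indecomposableAvoiders-isPerm α′∈) (All.lookup indecomposableAvoiders-nonempty α′∈) (λ ())))

mainTheorem6 : ((n : ℕ) → 5 ≤ n → (π : List ℕ) → IsPerm π → length π ≡ n → AvoidsR4 π → SumDecomposable π)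
    × ((α β : List ℕ) → IsPerm α → IsPerm β → α ≢ [] → SumIndecomposable α → AvoidsR4 (α ⊕ β)
    → α ∈ ((1 ∷ []) ∷ (2 ∷ 1 ∷ []) ∷ (2 ∷ 3 ∷ 1 ∷ []) ∷ (3 ∷ 2 ∷ 1 ∷ []) ∷ (3 ∷ 1 ∷ 2 ∷ []) ∷ (2 ∷ 4 ∷ 1 ∷ 3 ∷ []) ∷ []))
mainTheorem6 =
  (λ { _ 5≤n π p refl av → R4Free-perm-decomposable p 5≤n (avoids⇒R4Free π av) }) ,
  (λ α β pα _ α≢[] indec av →
    indecomposable-R4Free-listed pα α≢[] indec (R4Free-++ˡ α (avoids⇒R4Free (α ⊕ β) av)))
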